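{- Let $A$ be a formula of $\mathcal{L}$ and let $B$ be a diversified formula of $\mathcal{L}_{\wedge,\vee}$ containing a letter $q$ that does not occur in $A$. Then $A\leftrightarrow B$ is not a tautology.
   Context: $\mathcal{L}$ is the propositional language generated from an infinite set of propositional letters by the nullary connectives $\top,\bot$, the unary connective $\neg$ and the binary connectives $\wedge,\vee$; $\leftrightarrow$ is the usual defined (material) equivalence. $\mathcal{L}_{\wedge,\vee}$ is the sublanguage built from letters using only $\wedge$ and $\vee$. A formula is diversified when every letter occurs in it at most once. Tautology means classical tautology. -}

module Defs where

open import Data.Nat using (ℕ; _+_; _≤_; _≡ᵇ_)
open import Data.Bool using (Bool; true; false; not; _∧_; _∨_; if_then_else_)
open import Relation.Binary.PropositionalEquality using (_≡_)
open import Data.Unit using (⊤)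
open import Data.Empty using (⊥)
open import Data.Product using (_×_)
open import Data.Sum using (_⊎_)

data Form : Set where
  var  : ℕ → Form
  top  : Form
  bot  : Form
  neg  : Form → Form
  conj : Form → Form → Form
  disj : Form → Form → Form

iff : Form → Form → Form
iff A B = disj (conj A B) (conj (neg A) (neg B))

Valuation : Set
Valuation = ℕ → Bool

eval : Valuation → Form → Bool
eval v (var p)    = v p
eval v top        = true
eval v bot        = false
eval v (neg A)    = not (eval v A)
eval v (conj A B) = eval v A ∧ eval v B
eval v (disj A B) = eval v A ∨ eval v B

Tautology : Form → Set
Tautology A = (v : Valuation) → eval v A ≡ true

occ : ℕ → Form → ℕ
occ p (var q)    = if p ≡ᵇ q then 1 else 0
occ p top        = 0
occ p bot        = 0
occ p (neg A)    = occ p A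
occ p (conj A B) = occ p A + occ p B
occ p (disj A B) = occ p A + occ p B

Occurs : ℕ → Form → Set
Occurs p (var q)    = p ≡ q
Occurs p top        = ⊥
Occurs p bot        = ⊥
Occurs p (neg A)    = Occurs p A
Occurs p (conj A B) = Occurs p A ⊎ Occurs p B
Occurs p (disj A B) = Occurs p A ⊎ Occurs p B

Diversified : Form → Set
Diversified A = (p : ℕ) → occ p A ≤ 1

InAndOr : Form → Set
InAndOr (var p)    = ⊤
InAndOr top        = ⊥
InAndOr bot        = ⊥
InAndOr (neg A)    = ⊥
InAndOr (conj A B) = InAndOr A × InAndOr B
InAndOr (disj A B) = InAndOr A × InAndOr B

module Submission where

open import Defs
open import Data.Nat using (ℕ; _≤_; _≟_; _≡ᵇ_; z≤n; s≤s)
open import Data.Nat.Properties using (≡⇒≡ᵇ; ≤-trans; m≤m+n; m≤n+m; +-mono-≤)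
open import Data.Bool using (Bool; true; false; not; _∧_; _∨_; if_then_else_)
open import Data.Bool.Properties using (∧-identityʳ; ∨-identityʳ; ∧-idem; ∨-idem)
open import Data.Product using (Σ; _,_; _×_; proj₂)
open import Data.Sum using (_⊎_; inj₁; inj₂; swap)
open import Data.Empty using (⊥)
open import Function using (_∘_)
open import Relation.Nullary using (¬_; Dec; yes; no; does; contradiction)
open import Relation.Nullary.Decidable using (_⊎-dec_)
open import Relation.Binary.PropositionalEquality
  using (_≡_; _≢_; refl; sym; trans; cong; cong₂)
open Relation.Binary.PropositionalEquality.≡-Reasoning

-- Since B is diversified and built from ∧ and ∨ only, there is a valuation w such that
-- setting q to b and every other letter as in w makes B evaluate to b: along the path
-- to q, the sibling of each ∧ is made true and that of each ∨ false. A does not mention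
-- q, so its value is the same for b = true and b = false, and A ↔ B fails for one of them.

private
  variable
    x q : ℕ
    c : Bool
    v w : Valuation

occurs? : ∀ x C → Dec (Occurs x C)
occurs? x (var p)    = x ≟ p
occurs? x top        = no λ ()
occurs? x bot        = no λ ()
occurs? x (neg C)    = occurs? x C
occurs? x (conj L R) = occurs? x L ⊎-dec occurs? x R
occurs? x (disj L R) = occurs? x L ⊎-dec occurs? x R

Occurs⇒1≤occ : ∀ C → Occurs x C → 1 ≤ occ x C
Occurs⇒1≤occ {x} (var p) refl with x ≡ᵇ x | ≡⇒≡ᵇ x x refl
... | true | _ = s≤s z≤n
Occurs⇒1≤occ (neg C)    o        = Occurs⇒1≤occ C o
Occurs⇒1≤occ (conj L R) (inj₁ o) = ≤-trans (Occurs⇒1≤occ L o) (m≤m+n _ _)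
Occurs⇒1≤occ (conj L R) (inj₂ o) = ≤-trans (Occurs⇒1≤occ R o) (m≤n+m _ _)
Occurs⇒1≤occ (disj L R) (inj₁ o) = ≤-trans (Occurs⇒1≤occ L o) (m≤m+n _ _)
Occurs⇒1≤occ (disj L R) (inj₂ o) = ≤-trans (Occurs⇒1≤occ R o) (m≤n+m _ _)

Disjoint : Form → Form → Set
Disjoint S T = ∀ x → Occurs x S → Occurs x T → ⊥

Disjoint-sym : ∀ S T → Disjoint S T → Disjoint T S
Disjoint-sym S T disjoint = λ x o o′ → disjoint x o′ o

-- Diversified (disj L R) unfolds to the same type, so these serve ∨ as well.
Diversified-disjoint : ∀ L R → Diversified (conj L R) → Disjoint L R
Diversified-disjoint L R div x oL oR
  with ≤-trans (+-mono-≤ (Occurs⇒1≤occ L oL) (Occurs⇒1≤occ R oR)) (div x)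
... | s≤s ()

Diversified-left : ∀ L R → Diversified (conj L R) → Diversified L
Diversified-left L R div p = ≤-trans (m≤m+n _ _) (div p)

Diversified-right : ∀ L R → Diversified (conj L R) → Diversified R
Diversified-right L R div p = ≤-trans (m≤n+m _ _) (div p)

eval-agree : ∀ C → (∀ x → Occurs x C → v x ≡ w x) → eval v C ≡ eval w C
eval-agree (var p)    agree = agree p refl
eval-agree top        agree = refl
eval-agree bot        agree = refl
eval-agree (neg C)    agree = cong not (eval-agree C agree)
eval-agree (conj L R) agree =
  cong₂ _∧_ (eval-agree L λ x → agree x ∘ inj₁) (eval-agree R λ x → agree x ∘ inj₂)
eval-agree (disj L R) agree =
  cong₂ _∨_ (eval-agree L λ x → agree x ∘ inj₁) (eval-agree R λ x → agree x ∘ inj₂)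

eval-constant : ∀ C → InAndOr C → (∀ x → Occurs x C → v x ≡ c) → eval v C ≡ c
eval-constant (var p) _ const = const p refl
eval-constant {c = c} (conj L R) (l , r) const = trans
  (cong₂ _∧_ (eval-constant L l λ x → const x ∘ inj₁) (eval-constant R r λ x → const x ∘ inj₂))
  (∧-idem c)
eval-constant {c = c} (disj L R) (l , r) const = trans
  (cong₂ _∨_ (eval-constant L l λ x → const x ∘ inj₁) (eval-constant R r λ x → const x ∘ inj₂))
  (∨-idem c)

override : Form → Bool → Valuation → Valuation
override S c w x = if does (occurs? x S) then c else w x

override-inside : ∀ S w x → Occurs x S → override S c w x ≡ c
override-inside S w x o with occurs? x S
... | yes _ = refl
... | no ¬o = contradiction o ¬o

override-outside : ∀ S w x → ¬ Occurs x S → override S c w x ≡ w x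
override-outside S w x ¬o with occurs? x S
... | yes o = contradiction o ¬o
... | no _  = refl

Controls : ℕ → Valuation → Form → Set
Controls q w B = ∀ v → (∀ x → x ≢ q → Occurs x B → v x ≡ w x) → eval v B ≡ v q

assign : ℕ → Bool → Valuation → Valuation
assign q = override (var q)

Controls-assign : ∀ B → Controls q w B → ∀ b → eval (assign q b w) B ≡ b
Controls-assign {q} {w} B controls b =
  trans (controls _ λ x x≢q _ → override-outside (var q) w x x≢q)
        (override-inside (var q) w q refl)

split-agreement : ∀ S T → Occurs q S → Disjoint S T →
  (∀ x → x ≢ q → Occurs x S ⊎ Occurs x T → v x ≡ override T c w x) →
  (∀ x → x ≢ q → Occurs x S → v x ≡ w x) × (∀ x → Occurs x T → v x ≡ c)
split-agreement {q} {w = w} S T q∈S disjoint agree =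
    (λ x x≢q x∈S → trans (agree x x≢q (inj₁ x∈S)) (override-outside T w x (disjoint x x∈S)))
  , (λ x x∈T → trans (agree x (x≢q x∈T) (inj₂ x∈T)) (override-inside T w x x∈T))
  where
  x≢q : ∀ {x} → Occurs x T → x ≢ q
  x≢q x∈T refl = disjoint q q∈S x∈T

controlling-valuation : ∀ q B → InAndOr B → Diversified B → Occurs q B →
  Σ Valuation λ w → Controls q w B
controlling-valuation q (var p) _ _ refl = (λ _ → true) , λ v _ → refl
controlling-valuation q (conj L R) (l , r) div (inj₁ q∈L)
  with w , controls ← controlling-valuation q L l (Diversified-left L R div) q∈L =
  override R true w , λ v agree →
    let onL , onR = split-agreement L R q∈L (Diversified-disjoint L R div) agree
    in trans (cong₂ _∧_ (controls v onL) (eval-constant R r onR)) (∧-identityʳ (v q))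
controlling-valuation q (conj L R) (l , r) div (inj₂ q∈R)
  with w , controls ← controlling-valuation q R r (Diversified-right L R div) q∈R =
  override L true w , λ v agree →
    let onR , onL = split-agreement R L q∈R (Disjoint-sym L R (Diversified-disjoint L R div))
                                    (λ x x≢q → agree x x≢q ∘ swap)
    in cong₂ _∧_ (eval-constant L l onL) (controls v onR)
controlling-valuation q (disj L R) (l , r) div (inj₁ q∈L)
  with w , controls ← controlling-valuation q L l (Diversified-left L R div) q∈L =
  override R false w , λ v agree →
    let onL , onR = split-agreement L R q∈L (Diversified-disjoint L R div) agree
    in trans (cong₂ _∨_ (controls v onL) (eval-constant R r onR)) (∨-identityʳ (v q))
controlling-valuation q (disj L R) (l , r) div (inj₂ q∈R)
  with w , controls ← controlling-valuation q R r (Diversified-right L R div) q∈R =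
  override L false w , λ v agree →
    let onR , onL = split-agreement R L q∈R (Disjoint-sym L R (Diversified-disjoint L R div))
                                    (λ x x≢q → agree x x≢q ∘ swap)
    in cong₂ _∨_ (eval-constant L l onL) (controls v onR)

eval-iff-true : ∀ v A B → eval v (iff A B) ≡ true → eval v A ≡ eval v B
eval-iff-true v A B with eval v A | eval v B
... | true  | true  = λ _ → refl
... | false | false = λ _ → refl
... | true  | false = λ ()
... | false | true  = λ ()

eval-assign-absent : ∀ A → ¬ Occurs q A → ∀ b b′ →
  eval (assign q b w) A ≡ eval (assign q b′ w) A
eval-assign-absent {q} {w} A q∉A b b′ = eval-agree A λ x x∈A →
  let x≢q = λ { refl → q∉A x∈A }
  in trans (override-outside (var q) w x x≢q) (sym (override-outside (var q) w x x≢q))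

Controls⇒¬Tautology-iff : ∀ A B → ¬ Occurs q A → Controls q w B → ¬ Tautology (iff A B)
Controls⇒¬Tautology-iff {q} {w} A B q∉A controls taut with () ← begin
  true                      ≡⟨ sym (Controls-assign B controls true) ⟩
  eval (assign q true w) B  ≡⟨ sym (eval-iff-true _ A B (taut _)) ⟩
  eval (assign q true w) A  ≡⟨ eval-assign-absent A q∉A true false ⟩
  eval (assign q false w) A ≡⟨ eval-iff-true _ A B (taut _) ⟩
  eval (assign q false w) B ≡⟨ Controls-assign B controls false ⟩
  false                     ∎

lemma2 : (A B : Form) (q : ℕ) → InAndOr B → Diversified B → Occurs q B → ¬ Occurs q A →
    ¬ Tautology (iff A B)
lemma2 A B q andOr div q∈B q∉A =
  Controls⇒¬Tautology-iff A B q∉A (proj₂ (controlling-valuation q B andOr div q∈B))
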